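{- Let $a,b$ be integers with $a\ge b\ge2$. Then \[\overline{p}(a\mid \text{no } 1\text{'s})\;\overline{p}(b\mid \text{no } 2\text{'s}) > \overline{p}(a+b\mid \text{no } 1\text{'s and no } 2\text{'s}).\]
   Context: An overpartition of $n$ is a partition of $n$ in which the last occurrence of each distinct part may be overlined. $\overline{p}(n\mid \text{condition})$ denotes the number of overpartitions of $n$ satisfying the condition. The condition "no $i$'s" means that no part is a non-overlined part equal to $i$ (an overlined part $\overline{i}$ is allowed), for $i=1,2$. -}

module Defs where

open import Data.Nat using (ℕ; zero; suc; _+_; _*_; _∸_; _≤ᵇ_; _≡ᵇ_)
open import Data.Bool using (Bool; true; false; not; _∧_; _∨_; if_then_else_)
open import Data.Product using (_×_; _,_)
open import Data.List using (List; []; _∷_; _++_; map; concatMap; length; filter; replicate; upTo)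
open import Data.Bool.ListAction using (any)
open import Function using (_∘_)
open import Relation.Nullary.Decidable using (does)
open import Data.Bool.Properties using (T?)

-- An overpartition is represented as a list of parts (value , overlined?),
-- listed in weakly decreasing order of value; for each distinct value v the
-- non-overlined copies of v come first and at most one copy (the last
-- occurrence) is overlined.  This is the canonical form of an overpartition,
-- so overpartitions of n correspond bijectively to such lists.
Part : Set
Part = ℕ × Bool

OverPartition : Set
OverPartition = List Part

⟦_⟧ : Bool → ℕ
⟦ true ⟧ = 1
⟦ false ⟧ = 0

block : ℕ → ℕ → Bool → OverPartition
block v m b = replicate m (v , false) ++ (if b then (v , true) ∷ [] else [])

gen : ℕ → ℕ → List OverPartition
gen zero zero = [] ∷ []
gen zero (suc _) = []
gen (suc k) n =
  concatMap (λ b →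
    concatMap (λ m →
      if (suc k * (m + ⟦ b ⟧)) ≤ᵇ n
        then map (block (suc k) m b ++_) (gen k (n ∸ suc k * (m + ⟦ b ⟧)))
        else [])
      (upTo (suc n)))
    (false ∷ true ∷ [])

-- all overpartitions of n (parts are ≥ 1, hence ≤ n)
overpartitions : ℕ → List OverPartition
overpartitions n = gen n n

hasPlain : ℕ → OverPartition → Bool
hasPlain i = any (λ { (v , o) → (v ≡ᵇ i) ∧ not o })

p̄ : (OverPartition → Bool) → ℕ → ℕ
p̄ cond n = length (filter (λ π → T? (cond π)) (overpartitions n))

no1 : OverPartition → Bool
no1 π = not (hasPlain 1 π)

no2 : OverPartition → Bool
no2 π = not (hasPlain 2 π)

no1no2 : OverPartition → Bool
no1no2 π = no1 π ∧ no2 π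

{-# OPTIONS --safe #-}
-- Write an overpartition λ of a + b with no plain 1's and no plain 2's in decreasing order and
-- cut it where its running size reaches a: the part x + y straddling the cut gives x to an
-- overpartition μ of a and y to an overpartition ν of b, in which y is recorded as y plain 1's.
-- The other parts come from λ, so ν has no plain 2, and μ has no plain 1 unless x is a plain 1;
-- then μ gets 1̄ instead and y ≥ 2 is recorded in ν by one of the devices of encodeRest, which
-- the decoder can tell apart. So λ ↦ (μ, ν) is injective, and it misses (2 + 2 + ⋯, b̄), whose
-- decoding has a plain 2.
module Submission where

open import Defs
open import Data.Nat using (ℕ; zero; suc; _+_; _*_; _∸_; _≤_; _<_; _≥_; _>_; z≤n; s≤s; _≤ᵇ_; _≡ᵇ_; _≟_; _<?_)
open import Data.Nat.Properties
open import Algebra.Properties.CommutativeSemigroup +-commutativeSemigroup using (x∙yz≈y∙xz)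
open import Data.Nat.ListAction using (sum)
open import Data.Nat.ListAction.Properties using (sum-++)
open import Data.Bool using (Bool; true; false; if_then_else_; T; not; _∧_; _∨_)
open import Data.Bool.Properties using (∨-conicalˡ; ∨-conicalʳ; ∧-zeroʳ; T-≡; T-not-≡; T-∧; T?)
open import Function.Bundles using (Equivalence)
open import Data.Unit using (tt)
open import Data.Maybe using (just)
open import Data.Maybe.Relation.Binary.Connected using (Connected; just; just-nothing)
open import Data.Product using (_×_; _,_; proj₁; proj₂; ∃; ∃₂; uncurry)
open import Data.Sum using (_⊎_; inj₁; inj₂)
open import Data.List using (List; []; _∷_; _++_; map; concatMap; length; filter; upTo; replicate; cartesianProduct; head)
open import Data.List.Properties using (++-assoc; ++-cancelˡ; ++-identityʳ; length-++; length-map; map-++)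
open import Data.List.Relation.Unary.All as All using (All; []; _∷_)
import Data.List.Relation.Unary.All.Properties as All
open import Data.List.Relation.Unary.Any using (here; there)
open import Data.List.Relation.Unary.Linked as Linked using (Linked; []; [-]; _∷_; _∷′_)
open import Data.List.Relation.Unary.Linked.Properties using (Linked⇒All)
open import Data.List.Membership.Propositional using (_∈_; _∉_; find; lose)
open import Data.List.Membership.Propositional.Properties
  using (∈-map⁺; ∈-map⁻; ∈-concatMap⁺; ∈-concatMap⁻; ∈-upTo⁺; ∈-filter⁺; ∈-filter⁻; ∈-cartesianProduct⁺)
open import Data.List.Relation.Binary.Subset.Propositional using (_⊆_)
open import Data.List.Relation.Unary.Unique.Propositional using (Unique)
import Data.List.Relation.Unary.Unique.Propositional.Properties as Unique
open import Data.List.Relation.Unary.AllPairs using ([]; _∷_)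
open import Relation.Binary.PropositionalEquality
open import Relation.Nullary using (¬_; yes; no)
open import Data.Empty using (⊥-elim)

-- Counting lists

module _ {A B : Set} where

  Unique-concatMap⁺ : (f : A → List B) (key : B → A) →
    (∀ {x z} → z ∈ f x → key z ≡ x) → (∀ x → Unique (f x)) →
    ∀ {xs} → Unique xs → Unique (concatMap f xs)
  Unique-concatMap⁺ f key key-f uf {[]} [] = []
  Unique-concatMap⁺ f key key-f uf {x ∷ xs} (x∉xs ∷ u) =
    Unique.++⁺ (uf x) (Unique-concatMap⁺ f key key-f uf u) disjoint
    where
    disjoint : ∀ {z} → ¬ (z ∈ f x × z ∈ concatMap f xs)
    disjoint (z∈fx , z∈rest) with find (∈-concatMap⁻ f {xs = xs} z∈rest)
    ... | y , y∈xs , z∈fy = All.lookup x∉xs y∈xs (trans (sym (key-f z∈fx)) (key-f z∈fy))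

  Unique-map⁺-on : (f : A → B) {xs : List A} → Unique xs →
    (∀ {x y} → x ∈ xs → y ∈ xs → f x ≡ f y → x ≡ y) → Unique (map f xs)
  Unique-map⁺-on f {[]} [] inj = []
  Unique-map⁺-on f {x ∷ xs} (x∉xs ∷ u) inj =
    All.map⁺ (All.tabulate λ y∈xs fx≡fy → All.lookup x∉xs y∈xs (inj (here refl) (there y∈xs) fx≡fy))
    ∷ Unique-map⁺-on f u (λ p q → inj (there p) (there q))

  length-cartesianProduct : (xs : List A) (ys : List B) →
    length (cartesianProduct xs ys) ≡ length xs * length ys
  length-cartesianProduct [] ys = refl
  length-cartesianProduct (x ∷ xs) ys = begin
    length (map (x ,_) ys ++ cartesianProduct xs ys)        ≡⟨ length-++ (map (x ,_) ys) ⟩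
    length (map (x ,_) ys) + length (cartesianProduct xs ys)
      ≡⟨ cong₂ _+_ (length-map (x ,_) ys) (length-cartesianProduct xs ys) ⟩
    length ys + length xs * length ys                        ∎
    where open ≡-Reasoning

module _ {A : Set} where

  ∈-if⁻ : ∀ c {xs : List A} {x} → x ∈ (if c then xs else []) → T c × x ∈ xs
  ∈-if⁻ true x∈xs = tt , x∈xs

  remove : ∀ {x : A} ys → x ∈ ys → List A
  remove (y ∷ ys) (here _) = ys
  remove (y ∷ ys) (there x∈ys) = y ∷ remove ys x∈ys

  length-remove : ∀ {x : A} ys (x∈ys : x ∈ ys) → length ys ≡ suc (length (remove ys x∈ys))
  length-remove (y ∷ ys) (here _) = refl
  length-remove (y ∷ ys) (there x∈ys) = cong suc (length-remove ys x∈ys)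

  ∈-remove⁺ : ∀ {x z : A} ys (x∈ys : x ∈ ys) → z ∈ ys → x ≢ z → z ∈ remove ys x∈ys
  ∈-remove⁺ (y ∷ ys) (here refl) (here refl) x≢z = ⊥-elim (x≢z refl)
  ∈-remove⁺ (y ∷ ys) (here refl) (there z∈ys) _ = z∈ys
  ∈-remove⁺ (y ∷ ys) (there x∈ys) (here refl) _ = here refl
  ∈-remove⁺ (y ∷ ys) (there x∈ys) (there z∈ys) x≢z = there (∈-remove⁺ ys x∈ys z∈ys x≢z)

  Unique-⊆⇒length-≤ : ∀ {xs ys : List A} → Unique xs → xs ⊆ ys → length xs ≤ length ys
  Unique-⊆⇒length-≤ {[]} _ _ = z≤n
  Unique-⊆⇒length-≤ {x ∷ xs} {ys} (x∉xs ∷ u) xs⊆ys =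
    subst (suc (length xs) ≤_) (sym (length-remove ys x∈ys))
      (s≤s (Unique-⊆⇒length-≤ u λ z∈xs → ∈-remove⁺ ys x∈ys (xs⊆ys (there z∈xs)) (All.lookup x∉xs z∈xs)))
    where
    x∈ys : x ∈ ys
    x∈ys = xs⊆ys (here refl)

length-<-injection : ∀ {A B : Set} (f : A → B) {xs : List A} {ys : List B} {y : B} →
  Unique xs → (∀ {x x′} → x ∈ xs → x′ ∈ xs → f x ≡ f x′ → x ≡ x′) →
  (∀ {x} → x ∈ xs → f x ∈ ys) → y ∈ ys → y ∉ map f xs → length xs < length ys
length-<-injection f {xs} {ys} {y} u inj f∈ys y∈ys y∉image =
  subst (_≤ length ys) (cong suc (length-map f xs)) (Unique-⊆⇒length-≤ unique covered)
  where
  unique : Unique (y ∷ map f xs)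
  unique = All.tabulate (λ z∈ y≡z → y∉image (subst (_∈ _) (sym y≡z) z∈)) ∷ Unique-map⁺-on f u inj
  covered : y ∷ map f xs ⊆ ys
  covered (here refl) = y∈ys
  covered (there z∈) with ∈-map⁻ f z∈
  ... | x , x∈xs , refl = f∈ys x∈xs

-- Canonical overpartitions and gen

infix 4 _⊳_

-- q may follow p in the canonical order of Defs: values weakly decrease, the overlined copy comes last.
_⊳_ : Part → Part → Set
(v , o) ⊳ (w , _) = w < v ⊎ (w ≡ v × o ≡ false)

Canonical : OverPartition → Set
Canonical = Linked _⊳_

size : OverPartition → ℕ
size l = sum (map proj₁ l)

AllParts : (ℕ → Set) → OverPartition → Set
AllParts P = All (λ p → P (proj₁ p))

Positive : OverPartition → Set
Positive = AllParts (1 ≤_)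

Bounded : ℕ → OverPartition → Set
Bounded k = AllParts (λ v → 1 ≤ v × v ≤ k)

size-++ : ∀ xs ys → size (xs ++ ys) ≡ size xs + size ys
size-++ xs ys = trans (cong sum (map-++ proj₁ xs ys)) (sum-++ (map proj₁ xs) (map proj₁ ys))

parts-≤-size : ∀ l → AllParts (_≤ size l) l
parts-≤-size [] = []
parts-≤-size ((v , o) ∷ l) =
  m≤m+n v (size l) ∷ All.map (λ w≤ → ≤-trans w≤ (m≤n+m (size l) v)) (parts-≤-size l)

⊳⇒≥ : ∀ {p q} → p ⊳ q → proj₁ q ≤ proj₁ p
⊳⇒≥ (inj₁ lt) = <⇒≤ lt
⊳⇒≥ (inj₂ (eq , _)) = ≤-reflexive eq

plain-⊳ : ∀ {v} q → proj₁ q ≤ v → (v , false) ⊳ q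
plain-⊳ q w≤v with m≤n⇒m<n∨m≡n w≤v
... | inj₁ w<v = inj₁ w<v
... | inj₂ w≡v = inj₂ (w≡v , refl)

⊳-respʳ-≥ : ∀ p {q r} → p ⊳ q → proj₁ r ≤ proj₁ q → p ⊳ r
⊳-respʳ-≥ _ (inj₁ w<v) r≤w = inj₁ (≤-<-trans r≤w w<v)
⊳-respʳ-≥ (v , .false) {r = r} (inj₂ (refl , refl)) r≤v = plain-⊳ r r≤v

canonical⇒≤-head : ∀ {x l} → Canonical (x ∷ l) → AllParts (_≤ proj₁ x) (x ∷ l)
canonical⇒≤-head {x} c =
  Linked⇒All {R = λ p q → proj₁ q ≤ proj₁ p} (λ q≤p r≤q → ≤-trans r≤q q≤p) {v = x} ≤-refl
    (Linked.map (λ {p} {q} → ⊳⇒≥ {p} {q}) c)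

canonical⇒<-bound : ∀ {v x l} → proj₁ x < v → Canonical (x ∷ l) → AllParts (_< v) (x ∷ l)
canonical⇒<-bound x<v c = All.map (λ w≤x → ≤-<-trans w≤x x<v) (canonical⇒≤-head c)

canonical-plain-∷ : ∀ {v ys} → AllParts (_≤ v) ys → Canonical ys → Canonical ((v , false) ∷ ys)
canonical-plain-∷ [] _ = [-]
canonical-plain-∷ {ys = y ∷ _} (y≤v ∷ _) c = plain-⊳ y y≤v ∷ c

canonical-overlined-∷ : ∀ {v ys} → AllParts (_< v) ys → Canonical ys → Canonical ((v , true) ∷ ys)
canonical-overlined-∷ [] _ = [-]
canonical-overlined-∷ (w<v ∷ _) c = inj₁ w<v ∷ c

canonical-plains++ : ∀ v m {ys} → AllParts (_≤ v) ys → Canonical ys →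
  Canonical (replicate m (v , false) ++ ys)
canonical-plains++ v zero _ c = c
canonical-plains++ v (suc m) ys≤v c =
  canonical-plain-∷ (All.++⁺ (All.replicate⁺ m ≤-refl) ys≤v) (canonical-plains++ v m ys≤v c)

overlinedCopy : ℕ → Bool → OverPartition
overlinedCopy v b = if b then (v , true) ∷ [] else []

block++-assoc : ∀ v m b ys → block v m b ++ ys ≡ replicate m (v , false) ++ (overlinedCopy v b ++ ys)
block++-assoc v m b ys = ++-assoc (replicate m (v , false)) (overlinedCopy v b) ys

size-block : ∀ v m b → size (block v m b) ≡ v * (m + ⟦ b ⟧)
size-block v zero false = sym (*-zeroʳ v)
size-block v zero true = trans (+-identityʳ v) (sym (*-identityʳ v))
size-block v (suc m) b = trans (cong (v +_) (size-block v m b)) (sym (*-suc v (m + ⟦ b ⟧)))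

block-parts : ∀ v m b → AllParts (_≡ v) (block v m b)
block-parts v m false = All.++⁺ (All.replicate⁺ m refl) []
block-parts v m true = All.++⁺ (All.replicate⁺ m refl) (refl ∷ [])

canonical-block++ : ∀ v m b {ys} → AllParts (_< v) ys → Canonical ys → Canonical (block v m b ++ ys)
canonical-block++ v m false {ys} ys<v c rewrite block++-assoc v m false ys =
  canonical-plains++ v m (All.map <⇒≤ ys<v) c
canonical-block++ v m true {ys} ys<v c rewrite block++-assoc v m true ys =
  canonical-plains++ v m (≤-refl ∷ All.map <⇒≤ ys<v) (canonical-overlined-∷ ys<v c)

bounded-block++ : ∀ k m b {ys} → Bounded k ys → Bounded (suc k) (block (suc k) m b ++ ys)
bounded-block++ k m b ys≤k =
  All.++⁺ (All.map (λ v≡ → ≤-trans (s≤s z≤n) (≤-reflexive (sym v≡)) , ≤-reflexive v≡)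
                   (block-parts (suc k) m b))
          (All.map (λ (1≤v , v≤k) → 1≤v , m≤n⇒m≤1+n v≤k) ys≤k)

splitBlock : ℕ → OverPartition → ℕ × Bool × OverPartition
splitBlock v [] = 0 , false , []
splitBlock v ((w , o) ∷ l) with w ≟ v | o
... | yes _ | false = let (m , b , r) = splitBlock v l in suc m , b , r
... | yes _ | true = 0 , true , l
... | no _ | _ = 0 , false , (w , o) ∷ l

splitBlock-< : ∀ {v ys} → AllParts (_< v) ys → splitBlock v ys ≡ (0 , false , ys)
splitBlock-< [] = refl
splitBlock-< {v} {(w , _) ∷ _} (w<v ∷ _) with w ≟ v
... | yes w≡v = ⊥-elim (<⇒≢ w<v w≡v)
... | no _ = refl

splitBlock-block++ : ∀ v m b {ys} → AllParts (_< v) ys → splitBlock v (block v m b ++ ys) ≡ (m , b , ys)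
splitBlock-block++ v zero false ys<v = splitBlock-< ys<v
splitBlock-block++ v zero true _ with v ≟ v
... | yes _ = refl
... | no v≢v = ⊥-elim (v≢v refl)
splitBlock-block++ v (suc m) b ys<v with v ≟ v
... | yes _ = cong (λ (m , b , r) → suc m , b , r) (splitBlock-block++ v m b ys<v)
... | no v≢v = ⊥-elim (v≢v refl)

canonical-overlined⇒< : ∀ {v l} → Canonical ((v , true) ∷ l) → AllParts (_< v) l
canonical-overlined⇒< [-] = []
canonical-overlined⇒< (inj₁ w<v ∷ c) = canonical⇒<-bound w<v c
canonical-overlined⇒< (inj₂ (_ , ()) ∷ _)

splitBlock-correct : ∀ v {l} → Canonical l → AllParts (_≤ v) l →
  let (m , b , r) = splitBlock v l in l ≡ block v m b ++ r × Canonical r × AllParts (_< v) r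
splitBlock-correct v {[]} _ _ = refl , [] , []
splitBlock-correct v {(w , o) ∷ l} c (w≤v ∷ l≤v) with w ≟ v | o
... | yes refl | false =
  let (l≡ , c′ , r<v) = splitBlock-correct v (Linked.tail c) l≤v in cong ((w , false) ∷_) l≡ , c′ , r<v
... | yes refl | true = refl , Linked.tail c , canonical-overlined⇒< c
... | no w≢v | _ = refl , c , canonical⇒<-bound (≤∧≢⇒< w≤v w≢v) c

-- layer is the body of gen, so that gen (suc k) n unfolds to concatMap (layers k n) (false ∷ true ∷ []).
layer : ℕ → ℕ → Bool → ℕ → List OverPartition
layer k n b m =
  if suc k * (m + ⟦ b ⟧) ≤ᵇ n
    then map (block (suc k) m b ++_) (gen k (n ∸ suc k * (m + ⟦ b ⟧)))
    else []

layers : ℕ → ℕ → Bool → List OverPartition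
layers k n b = concatMap (layer k n b) (upTo (suc n))

∈-layer⁻ : ∀ {k n b m l} → l ∈ layer k n b m →
  suc k * (m + ⟦ b ⟧) ≤ n × ∃ λ r → r ∈ gen k (n ∸ suc k * (m + ⟦ b ⟧)) × l ≡ block (suc k) m b ++ r
∈-layer⁻ {k} {n} {b} {m} l∈ with ∈-if⁻ (suc k * (m + ⟦ b ⟧) ≤ᵇ n) l∈
... | fits , l∈image = ≤ᵇ⇒≤ _ _ fits , ∈-map⁻ (block (suc k) m b ++_) l∈image

∈-gen-suc⁻ : ∀ {k n l} → l ∈ gen (suc k) n → ∃₂ λ b m → l ∈ layer k n b m
∈-gen-suc⁻ {k} {n} l∈ with find (∈-concatMap⁻ (layers k n) {xs = false ∷ true ∷ []} l∈)
... | b , _ , l∈b with find (∈-concatMap⁻ (layer k n b) {xs = upTo (suc n)} l∈b)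
... | m , _ , l∈layer = b , m , l∈layer

∈-gen-suc⁺ : ∀ {k n} m b {r} → suc k * (m + ⟦ b ⟧) ≤ n → r ∈ gen k (n ∸ suc k * (m + ⟦ b ⟧)) →
  block (suc k) m b ++ r ∈ gen (suc k) n
∈-gen-suc⁺ {k} {n} m b {r} fits r∈ =
  ∈-concatMap⁺ (layers k n) (lose (bool∈ b) (∈-concatMap⁺ (layer k n b) (lose (∈-upTo⁺ m≤n) in-layer)))
  where
  bool∈ : ∀ b → b ∈ false ∷ true ∷ []
  bool∈ false = here refl
  bool∈ true = there (here refl)
  m≤n : m < suc n
  m≤n = s≤s (≤-trans (m≤m+n m ⟦ b ⟧) (≤-trans (m≤n*m (m + ⟦ b ⟧) (suc k)) fits))
  in-layer : block (suc k) m b ++ r ∈ layer k n b m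
  in-layer with suc k * (m + ⟦ b ⟧) ≤ᵇ n | ≤⇒≤ᵇ fits
  ... | true | _ = ∈-map⁺ (block (suc k) m b ++_) r∈

gen-sound : ∀ k {n l} → l ∈ gen k n → Canonical l × Bounded k l × size l ≡ n
gen-sound zero {zero} (here refl) = [] , [] , refl
gen-sound (suc k) {n} l∈ with ∈-gen-suc⁻ l∈
... | b , m , l∈layer with ∈-layer⁻ {k} {n} {b} {m} l∈layer
... | fits , r , r∈ , refl with gen-sound k r∈
... | c , r≤k , size-r =
  canonical-block++ (suc k) m b (All.map (λ (_ , v≤k) → s≤s v≤k) r≤k) c ,
  bounded-block++ k m b r≤k ,
  (begin
    size (block (suc k) m b ++ r)     ≡⟨ size-++ (block (suc k) m b) r ⟩
    size (block (suc k) m b) + size r ≡⟨ cong₂ _+_ (size-block (suc k) m b) size-r ⟩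
    s + (n ∸ s)                       ≡⟨ m+[n∸m]≡n fits ⟩
    n                                 ∎)
  where
  open ≡-Reasoning
  s : ℕ
  s = suc k * (m + ⟦ b ⟧)

gen-complete : ∀ k {n l} → Canonical l → Bounded k l → size l ≡ n → l ∈ gen k n
gen-complete zero {l = []} _ _ refl = here refl
gen-complete zero {l = _ ∷ _} _ ((1≤v , v≤0) ∷ _) _ = ⊥-elim (1+n≰n (≤-trans 1≤v v≤0))
gen-complete (suc k) {n} {l} c l≤k size-l
  with splitBlock (suc k) l | splitBlock-correct (suc k) c (All.map proj₂ l≤k)
... | m , b , r | refl , c′ , r<k = ∈-gen-suc⁺ m b fits (gen-complete k c′ r≤k′ size-r)
  where
  s : ℕ
  s = suc k * (m + ⟦ b ⟧)
  size-l′ : s + size r ≡ n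
  size-l′ = trans (cong (_+ size r) (sym (size-block (suc k) m b)))
                  (trans (sym (size-++ (block (suc k) m b) r)) size-l)
  fits : s ≤ n
  fits = subst (s ≤_) size-l′ (m≤m+n s (size r))
  size-r : size r ≡ n ∸ s
  size-r = sym (trans (cong (_∸ s) (sym size-l′)) (m+n∸m≡n s (size r)))
  r≤k′ : Bounded k r
  r≤k′ = All.zipWith (λ ((1≤v , _) , v<k) → 1≤v , ≤-pred v<k) (All.++⁻ʳ (block (suc k) m b) l≤k , r<k)

gen-unique : ∀ k n → Unique (gen k n)
gen-unique zero zero = [] ∷ []
gen-unique zero (suc n) = []
gen-unique (suc k) n =
  Unique-concatMap⁺ (layers k n) (λ l → proj₁ (proj₂ (splitBlock (suc k) l))) overlined-key
    (λ b → Unique-concatMap⁺ (layer k n b) (λ l → proj₁ (splitBlock (suc k) l)) (count-key b)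
             (layer-unique b) (Unique.upTo⁺ (suc n)))
    {false ∷ true ∷ []} (((λ ()) ∷ []) ∷ [] ∷ [])
  where
  splitBlock-layer : ∀ {b m l} → l ∈ layer k n b m → ∃ λ r → splitBlock (suc k) l ≡ (m , b , r)
  splitBlock-layer {b} {m} l∈ with ∈-layer⁻ {k} {n} {b} {m} l∈
  ... | _ , r , r∈ , refl =
    r , splitBlock-block++ (suc k) m b (All.map (λ (_ , v≤k) → s≤s v≤k) (proj₁ (proj₂ (gen-sound k r∈))))
  count-key : ∀ b {m l} → l ∈ layer k n b m → proj₁ (splitBlock (suc k) l) ≡ m
  count-key b l∈ = cong proj₁ (proj₂ (splitBlock-layer l∈))
  overlined-key : ∀ {b l} → l ∈ layers k n b → proj₁ (proj₂ (splitBlock (suc k) l)) ≡ b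
  overlined-key {b} l∈ with find (∈-concatMap⁻ (layer k n b) {xs = upTo (suc n)} l∈)
  ... | _ , _ , l∈layer = cong (λ t → proj₁ (proj₂ t)) (proj₂ (splitBlock-layer l∈layer))
  layer-unique : ∀ b m → Unique (layer k n b m)
  layer-unique b m with suc k * (m + ⟦ b ⟧) ≤ᵇ n
  ... | true = Unique.map⁺ (λ {x} {y} → ++-cancelˡ (block (suc k) m b) x y) (gen-unique k _)
  ... | false = []

record IsOverpartition (n : ℕ) (l : OverPartition) : Set where
  field
    canonical : Canonical l
    positive : Positive l
    size≡ : size l ≡ n

∈-overpartitions⁻ : ∀ {n l} → l ∈ overpartitions n → IsOverpartition n l
∈-overpartitions⁻ {n} l∈ with gen-sound n l∈
... | c , l≤n , size-l = record { canonical = c ; positive = All.map proj₁ l≤n ; size≡ = size-l }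

∈-overpartitions⁺ : ∀ {n l} → IsOverpartition n l → l ∈ overpartitions n
∈-overpartitions⁺ {l = l} record { canonical = c ; positive = pos ; size≡ = refl } =
  gen-complete (size l) c (All.zip (pos , parts-≤-size l)) refl

Unique-overpartitions : ∀ n → Unique (overpartitions n)
Unique-overpartitions n = gen-unique n n

-- Plain parts

isPlain : ℕ → Part → Bool
isPlain i (v , o) = (v ≡ᵇ i) ∧ not o

NoPlain : ℕ → OverPartition → Set
NoPlain i = All (λ p → isPlain i p ≡ false)

hasPlain≡false⇒NoPlain : ∀ i l → hasPlain i l ≡ false → NoPlain i l
hasPlain≡false⇒NoPlain i [] _ = []
hasPlain≡false⇒NoPlain i ((v , o) ∷ l) e =
  ∨-conicalˡ _ _ e ∷ hasPlain≡false⇒NoPlain i l (∨-conicalʳ _ _ e)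

NoPlain⇒hasPlain≡false : ∀ i l → NoPlain i l → hasPlain i l ≡ false
NoPlain⇒hasPlain≡false i [] [] = refl
NoPlain⇒hasPlain≡false i ((v , o) ∷ l) (e ∷ n) = cong₂ _∨_ e (NoPlain⇒hasPlain≡false i l n)

ones : ℕ → OverPartition
ones y = replicate y (1 , false)

#ones : OverPartition → ℕ
#ones [] = 0
#ones (p ∷ l) = if isPlain 1 p then suc (#ones l) else #ones l

dropOnes : OverPartition → OverPartition
dropOnes [] = []
dropOnes (p ∷ l) = if isPlain 1 p then dropOnes l else p ∷ dropOnes l

insertOnes : ℕ → OverPartition → OverPartition
insertOnes y [] = ones y
insertOnes y (p ∷ l) = if proj₁ p ≤ᵇ 1 then ones y ++ p ∷ l else p ∷ insertOnes y l

#ones-NoPlain : ∀ {l} → NoPlain 1 l → #ones l ≡ 0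
#ones-NoPlain [] = refl
#ones-NoPlain (e ∷ n) rewrite e = #ones-NoPlain n

dropOnes-NoPlain : ∀ {l} → NoPlain 1 l → dropOnes l ≡ l
dropOnes-NoPlain [] = refl
dropOnes-NoPlain {p ∷ _} (e ∷ n) rewrite e = cong (p ∷_) (dropOnes-NoPlain n)

#ones-ones++ : ∀ y z → #ones (ones y ++ z) ≡ y + #ones z
#ones-ones++ zero z = refl
#ones-ones++ (suc y) z = cong suc (#ones-ones++ y z)

dropOnes-ones++ : ∀ y z → dropOnes (ones y ++ z) ≡ dropOnes z
dropOnes-ones++ zero z = refl
dropOnes-ones++ (suc y) z = dropOnes-ones++ y z

size-ones : ∀ y → size (ones y) ≡ y
size-ones zero = refl
size-ones (suc y) = cong suc (size-ones y)

#ones-insertOnes : ∀ y {t} → NoPlain 1 t → #ones (insertOnes y t) ≡ y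
#ones-insertOnes y {[]} [] =
  trans (cong #ones (sym (++-identityʳ (ones y)))) (trans (#ones-ones++ y []) (+-identityʳ y))
#ones-insertOnes y {p ∷ l} (e ∷ n) with proj₁ p ≤ᵇ 1
... | true =
  trans (#ones-ones++ y (p ∷ l)) (trans (cong (y +_) (#ones-NoPlain {p ∷ l} (e ∷ n))) (+-identityʳ y))
... | false rewrite e = #ones-insertOnes y n

dropOnes-insertOnes : ∀ y {t} → NoPlain 1 t → dropOnes (insertOnes y t) ≡ t
dropOnes-insertOnes y {[]} [] = trans (cong dropOnes (sym (++-identityʳ (ones y)))) (dropOnes-ones++ y [])
dropOnes-insertOnes y {p ∷ l} (e ∷ n) with proj₁ p ≤ᵇ 1
... | true = trans (dropOnes-ones++ y (p ∷ l)) (dropOnes-NoPlain {p ∷ l} (e ∷ n))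
... | false rewrite e = cong (p ∷_) (dropOnes-insertOnes y n)

size-insertOnes : ∀ y t → size (insertOnes y t) ≡ y + size t
size-insertOnes y [] = trans (size-ones y) (sym (+-identityʳ y))
size-insertOnes y ((v , o) ∷ l) with v ≤ᵇ 1
... | true = trans (size-++ (ones y) ((v , o) ∷ l)) (cong (_+ size ((v , o) ∷ l)) (size-ones y))
... | false = trans (cong (v +_) (size-insertOnes y l)) (x∙yz≈y∙xz v y (size l))

NoPlain2-insertOnes : ∀ y {t} → NoPlain 2 t → NoPlain 2 (insertOnes y t)
NoPlain2-insertOnes y {[]} _ = All.replicate⁺ y refl
NoPlain2-insertOnes y {p ∷ l} (e ∷ n) with proj₁ p ≤ᵇ 1
... | true = All.++⁺ (All.replicate⁺ y refl) (e ∷ n)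
... | false = e ∷ NoPlain2-insertOnes y n

positive-insertOnes : ∀ y {t} → Positive t → Positive (insertOnes y t)
positive-insertOnes y {[]} _ = All.replicate⁺ y (s≤s z≤n)
positive-insertOnes y {p ∷ l} (e ∷ n) with proj₁ p ≤ᵇ 1
... | true = All.++⁺ (All.replicate⁺ y (s≤s z≤n)) (e ∷ n)
... | false = e ∷ positive-insertOnes y n

⊳-head-insertOnes : ∀ {p} y t → Connected _⊳_ (just p) (head t) → 2 ≤ proj₁ p →
  Connected _⊳_ (just p) (head (insertOnes y t))
⊳-head-insertOnes zero [] _ _ = just-nothing
⊳-head-insertOnes (suc y) [] _ 2≤p = just (inj₁ 2≤p)
⊳-head-insertOnes y (q ∷ l) p⊳q 2≤p with proj₁ q ≤ᵇ 1
⊳-head-insertOnes zero (q ∷ l) p⊳q 2≤p | true = p⊳q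
⊳-head-insertOnes (suc y) (q ∷ l) p⊳q 2≤p | true = just (inj₁ 2≤p)
... | false = p⊳q

canonical-insertOnes : ∀ y {t} → Canonical t → Positive t → NoPlain 1 t → Canonical (insertOnes y t)
canonical-insertOnes y {[]} _ _ _ = subst Canonical (++-identityʳ (ones y)) (canonical-plains++ 1 y [] [])
canonical-insertOnes y {p ∷ l} c (_ ∷ pos) (_ ∷ n) with proj₁ p ≤ᵇ 1 in p≤ᵇ1
... | true = canonical-plains++ 1 y (All.map (λ w≤p → ≤-trans w≤p p≤1) (canonical⇒≤-head c)) c
  where p≤1 = ≤ᵇ⇒≤ _ 1 (subst T (sym p≤ᵇ1) tt)
... | false = ⊳-head-insertOnes y l (Linked.head′ c) (≰⇒> (λ p≤1 → subst T p≤ᵇ1 (≤⇒≤ᵇ p≤1)))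
              ∷′ canonical-insertOnes y (Linked.tail c) pos n

-- The injection

record Cut : Set where
  field
    front : OverPartition
    left : ℕ
    mark : Bool
    right : ℕ
    back : OverPartition

cut : ℕ → OverPartition → Cut
cut r [] = record { front = [] ; left = 0 ; mark = false ; right = 0 ; back = [] }
cut r ((v , o) ∷ l) with v <? r
... | yes _ = let c = cut (r ∸ v) l in record c { front = (v , o) ∷ Cut.front c }
... | no _ = record { front = [] ; left = r ; mark = o ; right = v ∸ r ; back = l }

cut-correct : ∀ r l → 1 ≤ r → r ≤ size l → let open Cut (cut r l) in
  l ≡ front ++ (left + right , mark) ∷ back × size front + left ≡ r × 1 ≤ left
cut-correct r [] 1≤r r≤0 = ⊥-elim (1+n≰n (≤-trans 1≤r r≤0))
cut-correct r ((v , o) ∷ l) 1≤r r≤size with v <? r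
... | yes v<r =
  let (l≡ , size≡ , 1≤left) = cut-correct (r ∸ v) l (m<n⇒0<n∸m v<r)
                                 (subst (r ∸ v ≤_) (m+n∸m≡n v (size l)) (∸-monoˡ-≤ v r≤size))
  in cong ((v , o) ∷_) l≡ , trans (+-assoc v _ _) (trans (cong (v +_) size≡) (m+[n∸m]≡n (<⇒≤ v<r))) , 1≤left
... | no v≮r = cong (λ w → (w , o) ∷ l) (sym (m+[n∸m]≡n (≮⇒≥ v≮r))) , refl , 1≤r

startsWith : ℕ → OverPartition → Bool
startsWith w [] = false
startsWith w ((v , _) ∷ _) = v ≡ᵇ w

-- The part cut at a was 1 + y with y ≥ 2, and its plain 1 goes to μ as 1̄;
-- ν must then record y in a way that decodeLast can tell apart from the other cases.
encodeRest : ℕ → OverPartition → OverPartition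
encodeRest y t =
  if startsWith (suc y) t then insertOnes y t
  else if 3 ≤ᵇ y then (y , false) ∷ t
  else (y + size t , true) ∷ []

encodeCut : OverPartition → ℕ → Bool → ℕ → OverPartition → OverPartition × OverPartition
encodeCut h 1 false y t = h ++ (1 , true) ∷ [] , encodeRest y t
encodeCut h x o y t = h ++ (x , o) ∷ [] , insertOnes y t

encode : ℕ → OverPartition → OverPartition × OverPartition
encode a l = let open Cut (cut a l) in encodeCut front left mark right back

startsAbove : ℕ → OverPartition → Bool
startsAbove c [] = false
startsAbove c ((v , _) ∷ _) = suc c ≤ᵇ v

-- the unique overpartition of n ≤ 3 into parts below 3 without plain 1's or 2's
smallRest : ℕ → OverPartition
smallRest 1 = (1 , true) ∷ []
smallRest 2 = (2 , true) ∷ []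
smallRest 3 = (2 , true) ∷ (1 , true) ∷ []
smallRest _ = []

decodeNoOnes : OverPartition → OverPartition
decodeNoOnes [] = []
decodeNoOnes ((v , false) ∷ t) = (suc v , false) ∷ t
decodeNoOnes ((v , true) ∷ _) = (3 , false) ∷ smallRest (v ∸ 2)

decodePlainOne : OverPartition → OverPartition
decodePlainOne ν = if #ones ν ≡ᵇ 0 then decodeNoOnes ν else (suc (#ones ν) , false) ∷ dropOnes ν

-- A final 1̄ of μ comes either from an overlined part 1 + y, and then dropOnes ν starts below
-- 1 + y, or from encodeRest.
fromPlainOne : OverPartition → Bool
fromPlainOne ν = (#ones ν ≡ᵇ 0) ∨ startsAbove (#ones ν) (dropOnes ν)

decodeLast : Part → OverPartition → OverPartition
decodeLast (1 , true) ν =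
  if fromPlainOne ν then decodePlainOne ν
  else (suc (#ones ν) , true) ∷ dropOnes ν
decodeLast (x , o) ν = (x + #ones ν , o) ∷ dropOnes ν

decode : OverPartition → OverPartition → OverPartition
decode [] ν = ν
decode (q ∷ []) ν = decodeLast q ν
decode (q ∷ q′ ∷ μ) ν = q ∷ decode (q′ ∷ μ) ν

decode-snoc : ∀ h q ν → decode (h ++ q ∷ []) ν ≡ h ++ decodeLast q ν
decode-snoc [] q ν = refl
decode-snoc (p ∷ []) q ν = refl
decode-snoc (p ∷ p′ ∷ h) q ν = cong (p ∷_) (decode-snoc (p′ ∷ h) q ν)

record Admissible (l : OverPartition) : Set where
  constructor admissible
  field
    canonical : Canonical l
    positive : Positive l
    noPlain1 : NoPlain 1 l
    noPlain2 : NoPlain 2 l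

canonical-++⁻ʳ : ∀ h {l} → Canonical (h ++ l) → Canonical l
canonical-++⁻ʳ [] c = c
canonical-++⁻ʳ (_ ∷ h) c = canonical-++⁻ʳ h (Linked.tail c)

admissible-++⁻ʳ : ∀ h {l} → Admissible (h ++ l) → Admissible l
admissible-++⁻ʳ h (admissible c pos n1 n2) =
  admissible (canonical-++⁻ʳ h c) (All.++⁻ʳ h pos) (All.++⁻ʳ h n1) (All.++⁻ʳ h n2)

admissible-tail : ∀ {p l} → Admissible (p ∷ l) → Admissible l
admissible-tail = admissible-++⁻ʳ (_ ∷ [])

overlined-one-last : ∀ {t} → Canonical ((1 , true) ∷ t) → Positive t → t ≡ []
overlined-one-last {[]} _ _ = refl
overlined-one-last {_ ∷ _} c (1≤v ∷ _) with canonical-overlined⇒< c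
... | v<1 ∷ _ = ⊥-elim (<⇒≱ v<1 1≤v)

smallRest-size : ∀ {t} → Admissible ((3 , false) ∷ t) → startsWith 3 t ≡ false → smallRest (size t) ≡ t
smallRest-size {[]} _ _ = refl
smallRest-size {(zero , _) ∷ _} (admissible _ (_ ∷ () ∷ _) _ _) _
smallRest-size {(1 , false) ∷ _} (admissible _ _ (_ ∷ () ∷ _) _) _
smallRest-size {(1 , true) ∷ _} (admissible (_ ∷ c) (_ ∷ _ ∷ pos) _ _) _ with overlined-one-last c pos
... | refl = refl
smallRest-size {(2 , false) ∷ _} (admissible _ _ _ (_ ∷ () ∷ _)) _
smallRest-size {(2 , true) ∷ []} _ _ = refl
smallRest-size {(2 , true) ∷ (zero , _) ∷ _} (admissible _ (_ ∷ _ ∷ () ∷ _) _ _) _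
smallRest-size {(2 , true) ∷ (1 , false) ∷ _} (admissible _ _ (_ ∷ _ ∷ () ∷ _) _) _
smallRest-size {(2 , true) ∷ (1 , true) ∷ _} (admissible (_ ∷ _ ∷ c) (_ ∷ _ ∷ _ ∷ pos) _ _) _
  with overlined-one-last c pos
... | refl = refl
smallRest-size {(2 , true) ∷ (suc (suc _) , _) ∷ _} (admissible (_ ∷ inj₁ (s≤s (s≤s ())) ∷ _) _ _ _) _
smallRest-size {(2 , true) ∷ (suc (suc _) , _) ∷ _} (admissible (_ ∷ inj₂ (_ , ()) ∷ _) _ _ _) _
smallRest-size {(3 , _) ∷ _} _ ()
smallRest-size {(suc (suc (suc (suc _))) , _) ∷ _} (admissible (inj₁ (s≤s (s≤s (s≤s ()))) ∷ _) _ _ _) _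
smallRest-size {(suc (suc (suc (suc _))) , _) ∷ _} (admissible (inj₂ (() , _) ∷ _) _ _ _) _

startsWith⇒startsAbove : ∀ y t → startsWith (suc y) t ≡ true → startsAbove y t ≡ true
startsWith⇒startsAbove y ((v , _) ∷ _) s with ≡ᵇ⇒≡ v (suc y) (Equivalence.from T-≡ s)
... | refl = Equivalence.to T-≡ (≤⇒≤ᵇ (≤-refl {suc y}))

overlined⇒¬startsAbove : ∀ y {t} → Canonical ((suc y , true) ∷ t) → startsAbove y t ≡ false
overlined⇒¬startsAbove y {[]} _ = refl
overlined⇒¬startsAbove y {(v , _) ∷ _} c with canonical-overlined⇒< c | suc y ≤ᵇ v in above
... | _ | false = refl
... | v<sy ∷ _ | true = ⊥-elim (<⇒≱ v<sy (≤ᵇ⇒≤ (suc y) v (Equivalence.from T-≡ above)))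

fromPlainOne-insertOnes : ∀ y {t} → NoPlain 1 t → fromPlainOne (insertOnes y t) ≡ (y ≡ᵇ 0) ∨ startsAbove y t
fromPlainOne-insertOnes y n1 =
  cong₂ (λ c u → (c ≡ᵇ 0) ∨ startsAbove c u) (#ones-insertOnes y n1) (dropOnes-insertOnes y n1)

decodeLast-1̄-plain : ∀ ν → fromPlainOne ν ≡ true →
  decodeLast (1 , true) ν ≡ decodePlainOne ν
decodeLast-1̄-plain ν e = cong (λ c → if c then decodePlainOne ν else (suc (#ones ν) , true) ∷ dropOnes ν) e

decodeLast-1̄-overlined : ∀ ν → fromPlainOne ν ≡ false →
  decodeLast (1 , true) ν ≡ (suc (#ones ν) , true) ∷ dropOnes ν
decodeLast-1̄-overlined ν e = cong (λ c → if c then decodePlainOne ν else (suc (#ones ν) , true) ∷ dropOnes ν) e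

decodePlainOne-ones : ∀ ν c → #ones ν ≡ suc c → decodePlainOne ν ≡ (suc (suc c) , false) ∷ dropOnes ν
decodePlainOne-ones ν c e = cong (λ c → if c ≡ᵇ 0 then decodeNoOnes ν else (suc c , false) ∷ dropOnes ν) e

decodeLast-encodeRest : ∀ z {t} → Admissible ((3 + z , false) ∷ t) →
  decodeLast (1 , true) (encodeRest (2 + z) t) ≡ (3 + z , false) ∷ t
decodeLast-encodeRest z {t} adm with startsWith (suc (suc (suc z))) t in s
... | true = begin
  decodeLast (1 , true) (insertOnes y t)      ≡⟨ decodeLast-1̄-plain (insertOnes y t) plain-case ⟩
  decodePlainOne (insertOnes y t)             ≡⟨ decodePlainOne-ones (insertOnes y t) (suc z) (#ones-insertOnes y n1) ⟩
  (suc y , false) ∷ dropOnes (insertOnes y t) ≡⟨ cong ((suc y , false) ∷_) (dropOnes-insertOnes y n1) ⟩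
  (suc y , false) ∷ t                         ∎
  where
  open ≡-Reasoning
  y : ℕ
  y = suc (suc z)
  n1 : NoPlain 1 t
  n1 = Admissible.noPlain1 (admissible-tail adm)
  plain-case : fromPlainOne (insertOnes y t) ≡ true
  plain-case = trans (fromPlainOne-insertOnes y n1) (startsWith⇒startsAbove y t s)
... | false with z
...   | zero = cong ((3 , false) ∷_) (smallRest-size adm s)
...   | suc _ rewrite #ones-NoPlain (Admissible.noPlain1 (admissible-tail adm)) = refl

decode-encodeCut : ∀ h x o y t → 1 ≤ x → Admissible ((x + y , o) ∷ t) → 2 ≤ y + size t →
  uncurry decode (encodeCut h x o y t) ≡ h ++ (x + y , o) ∷ t
decode-encodeCut h (suc zero) false zero t _ (admissible _ _ (() ∷ _) _) _
decode-encodeCut h (suc zero) false (suc zero) t _ (admissible _ _ _ (() ∷ _)) _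
decode-encodeCut h (suc zero) false (suc (suc z)) t _ adm _ =
  trans (decode-snoc h (1 , true) (encodeRest (2 + z) t)) (cong (h ++_) (decodeLast-encodeRest z adm))
decode-encodeCut h (suc zero) true zero t _ (admissible c pos _ _) 2≤size
  with overlined-one-last c (All.tail pos)
decode-encodeCut h (suc zero) true zero .[] _ _ () | refl
decode-encodeCut h (suc zero) true (suc y) t _ (admissible c _ (_ ∷ n1) _) _ = begin
  decode (h ++ (1 , true) ∷ []) ν           ≡⟨ decode-snoc h (1 , true) ν ⟩
  h ++ decodeLast (1 , true) ν              ≡⟨ cong (h ++_) (decodeLast-1̄-overlined ν overlined-case) ⟩
  h ++ (suc (#ones ν) , true) ∷ dropOnes ν  ≡⟨ cong₂ (λ m u → h ++ (suc m , true) ∷ u) (#ones-insertOnes (suc y) n1)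
                                                                                  (dropOnes-insertOnes (suc y) n1) ⟩
  h ++ (suc (suc y) , true) ∷ t             ∎
  where
  open ≡-Reasoning
  ν : OverPartition
  ν = insertOnes (suc y) t
  overlined-case : fromPlainOne ν ≡ false
  overlined-case = trans (fromPlainOne-insertOnes (suc y) n1) (overlined⇒¬startsAbove (suc y) c)
decode-encodeCut h (suc (suc x)) o y t _ (admissible _ _ (_ ∷ n1) _) _ = begin
  decode (h ++ (2 + x , o) ∷ []) ν          ≡⟨ decode-snoc h (2 + x , o) ν ⟩
  h ++ (2 + x + #ones ν , o) ∷ dropOnes ν   ≡⟨ cong₂ (λ m u → h ++ (2 + x + m , o) ∷ u) (#ones-insertOnes y n1)
                                                                                  (dropOnes-insertOnes y n1) ⟩
  h ++ (2 + x + y , o) ∷ t                  ∎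
  where
  open ≡-Reasoning
  ν : OverPartition
  ν = insertOnes y t

canonical-shrinkLast : ∀ h {p q t} → Canonical (h ++ p ∷ t) → proj₁ q ≤ proj₁ p → Canonical (h ++ q ∷ [])
canonical-shrinkLast [] _ _ = [-]
canonical-shrinkLast (r ∷ []) {p} {q} (r⊳p ∷ _) q≤p = ⊳-respʳ-≥ r {p} {q} r⊳p q≤p ∷ [-]
canonical-shrinkLast (r ∷ r′ ∷ h) (r⊳r′ ∷ c) q≤p = r⊳r′ ∷ canonical-shrinkLast (r′ ∷ h) c q≤p

canonical-decrement : ∀ {v t} → Canonical ((suc v , false) ∷ t) → startsWith (suc v) t ≡ false →
  Canonical ((v , false) ∷ t)
canonical-decrement [-] _ = [-]
canonical-decrement {v} {(w , o) ∷ _} (sv⊳w ∷ c) s =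
  plain-⊳ (w , o) (≤-pred (≤∧≢⇒< (⊳⇒≥ {suc v , false} {w , o} sv⊳w) w≢sv)) ∷ c
  where
  w≢sv : w ≢ suc v
  w≢sv w≡sv = subst T s (≡⇒≡ᵇ w (suc v) w≡sv)

encodeCut-last : ∀ h x o y t → ∃ λ o′ →
  proj₁ (encodeCut h x o y t) ≡ h ++ (x , o′) ∷ [] × isPlain 1 (x , o′) ≡ false
encodeCut-last h zero o y t = o , refl , refl
encodeCut-last h (suc zero) false y t = true , refl , refl
encodeCut-last h (suc zero) true y t = true , refl , refl
encodeCut-last h (suc (suc x)) o y t = o , refl , refl

encodeCut-front : ∀ h x o y t → 1 ≤ x → Admissible (h ++ (x + y , o) ∷ t) →
  let μ = proj₁ (encodeCut h x o y t) in IsOverpartition (size h + x) μ × NoPlain 1 μ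
encodeCut-front h x o y t 1≤x (admissible c pos n1 _) with encodeCut-last h x o y t
... | o′ , μ≡ , e = subst (λ μ → IsOverpartition (size h + x) μ × NoPlain 1 μ) (sym μ≡)
  (record { canonical = canonical-shrinkLast h c (m≤m+n x y)
          ; positive = All.++⁺ (All.++⁻ˡ h pos) (1≤x ∷ [])
          ; size≡ = trans (size-++ h ((x , o′) ∷ [])) (cong (size h +_) (+-identityʳ x)) } ,
   All.++⁺ (All.++⁻ˡ h n1) (e ∷ []))

insertOnes-valid : ∀ y {t} → Admissible t →
  IsOverpartition (y + size t) (insertOnes y t) × NoPlain 2 (insertOnes y t)
insertOnes-valid y {t} (admissible c pos n1 n2) =
  record { canonical = canonical-insertOnes y c pos n1
         ; positive = positive-insertOnes y pos
         ; size≡ = size-insertOnes y t } ,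
  NoPlain2-insertOnes y n2

encodeRest-valid : ∀ z {t} → Admissible ((3 + z , false) ∷ t) →
  IsOverpartition (2 + z + size t) (encodeRest (2 + z) t) × NoPlain 2 (encodeRest (2 + z) t)
encodeRest-valid z {t} adm with startsWith (3 + z) t in s
... | true = insertOnes-valid (2 + z) (admissible-tail adm)
... | false with z
...   | zero = record { canonical = [-] ; positive = s≤s z≤n ∷ [] ; size≡ = +-identityʳ _ } , ∧-zeroʳ _ ∷ []
...   | suc _ = record { canonical = canonical-decrement (Admissible.canonical adm) s
                       ; positive = s≤s z≤n ∷ All.tail (Admissible.positive adm)
                       ; size≡ = refl } ,
                refl ∷ All.tail (Admissible.noPlain2 adm)

encodeCut-back : ∀ h x o y t → 1 ≤ x → Admissible ((x + y , o) ∷ t) →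
  let ν = proj₂ (encodeCut h x o y t) in IsOverpartition (y + size t) ν × NoPlain 2 ν
encodeCut-back h (suc zero) false zero t _ (admissible _ _ (() ∷ _) _)
encodeCut-back h (suc zero) false (suc zero) t _ (admissible _ _ _ (() ∷ _))
encodeCut-back h (suc zero) false (suc (suc z)) t _ adm = encodeRest-valid z adm
encodeCut-back h (suc zero) true y t _ adm = insertOnes-valid y (admissible-tail adm)
encodeCut-back h (suc (suc x)) o y t _ adm = insertOnes-valid y (admissible-tail adm)

module _ {a b l} (1≤a : 1 ≤ a) (adm : Admissible l) (size-l : size l ≡ a + b) where
  open Cut (cut a l)

  private
    cut-facts : l ≡ front ++ (left + right , mark) ∷ back × size front + left ≡ a × 1 ≤ left
    cut-facts = cut-correct a l 1≤a (subst (a ≤_) (sym size-l) (m≤m+n a b))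

    l≡ : l ≡ front ++ (left + right , mark) ∷ back
    l≡ = proj₁ cut-facts

    size-front : size front + left ≡ a
    size-front = proj₁ (proj₂ cut-facts)

    1≤left : 1 ≤ left
    1≤left = proj₂ (proj₂ cut-facts)

    adm′ : Admissible (front ++ (left + right , mark) ∷ back)
    adm′ = subst Admissible l≡ adm

    size-back : right + size back ≡ b
    size-back = +-cancelˡ-≡ a _ _ (begin
      a + (right + size back)                       ≡⟨ cong (_+ (right + size back)) (sym size-front) ⟩
      (size front + left) + (right + size back)     ≡⟨ +-assoc (size front) left (right + size back) ⟩
      size front + (left + (right + size back))     ≡⟨ cong (size front +_) (sym (+-assoc left right (size back))) ⟩
      size front + ((left + right) + size back)     ≡⟨ sym (size-++ front ((left + right , mark) ∷ back)) ⟩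
      size (front ++ (left + right , mark) ∷ back)  ≡⟨ cong size (sym l≡) ⟩
      size l                                        ≡⟨ size-l ⟩
      a + b                                         ∎)
      where open ≡-Reasoning

  encode-front : IsOverpartition a (proj₁ (encode a l)) × NoPlain 1 (proj₁ (encode a l))
  encode-front = subst (λ n → IsOverpartition n (proj₁ (encode a l)) × NoPlain 1 (proj₁ (encode a l))) size-front
    (encodeCut-front front left mark right back 1≤left adm′)

  encode-back : IsOverpartition b (proj₂ (encode a l)) × NoPlain 2 (proj₂ (encode a l))
  encode-back = subst (λ n → IsOverpartition n (proj₂ (encode a l)) × NoPlain 2 (proj₂ (encode a l))) size-back
    (encodeCut-back front left mark right back 1≤left (admissible-++⁻ʳ front adm′))

  decode-encode : 2 ≤ b → uncurry decode (encode a l) ≡ l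
  decode-encode 2≤b =
    trans (decode-encodeCut front left mark right back 1≤left (admissible-++⁻ʳ front adm′)
                            (subst (2 ≤_) (sym size-back) 2≤b))
          (sym l≡)

twos : ℕ → OverPartition
twos zero = []
twos (suc zero) = (1 , true) ∷ []
twos (suc (suc n)) = (2 , false) ∷ twos n

twos-valid : ∀ n → IsOverpartition n (twos n) × NoPlain 1 (twos n)
twos-valid zero = record { canonical = [] ; positive = [] ; size≡ = refl } , []
twos-valid (suc zero) = record { canonical = [-] ; positive = s≤s z≤n ∷ [] ; size≡ = refl } , refl ∷ []
twos-valid (suc (suc n)) =
  record { canonical = head⊳ n ∷′ canonical ; positive = s≤s z≤n ∷ positive ; size≡ = cong (2 +_) size≡ } ,
  refl ∷ proj₂ (twos-valid n)
  where
  open IsOverpartition (proj₁ (twos-valid n))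
  head⊳ : ∀ n → Connected _⊳_ (just (2 , false)) (head (twos n))
  head⊳ zero = just-nothing
  head⊳ (suc zero) = just (inj₁ ≤-refl)
  head⊳ (suc (suc n)) = just (inj₂ (refl , refl))

¬NoPlain2-decode-twos : ∀ a b → 2 ≤ a → ¬ NoPlain 2 (decode (twos a) ((b , true) ∷ []))
¬NoPlain2-decode-twos 0 b ()
¬NoPlain2-decode-twos 1 b (s≤s ())
¬NoPlain2-decode-twos 2 b _ rewrite #ones-NoPlain {(b , true) ∷ []} (∧-zeroʳ (b ≡ᵇ 1) ∷ []) = λ { (() ∷ _) }
¬NoPlain2-decode-twos 3 b _ (() ∷ _)
¬NoPlain2-decode-twos (suc (suc (suc (suc _)))) b _ (() ∷ _)

-- The inequality

counted : (OverPartition → Bool) → ℕ → List OverPartition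
counted cond n = filter (λ π → T? (cond π)) (overpartitions n)

∈-counted⁺ : ∀ cond {n l} → IsOverpartition n l → T (cond l) → l ∈ counted cond n
∈-counted⁺ cond l-ok holds = ∈-filter⁺ (λ π → T? (cond π)) (∈-overpartitions⁺ l-ok) holds

∈-counted⁻ : ∀ cond {n l} → l ∈ counted cond n → IsOverpartition n l × T (cond l)
∈-counted⁻ cond {n} l∈ with ∈-filter⁻ (λ π → T? (cond π)) {xs = overpartitions n} l∈
... | l∈all , holds = ∈-overpartitions⁻ l∈all , holds

Unique-counted : ∀ cond n → Unique (counted cond n)
Unique-counted cond n = Unique.filter⁺ (λ π → T? (cond π)) (Unique-overpartitions n)

NoPlain⇒T-no : ∀ i {l} → NoPlain i l → T (not (hasPlain i l))
NoPlain⇒T-no i {l} n = Equivalence.from T-not-≡ (NoPlain⇒hasPlain≡false i l n)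

T-no1no2⇒NoPlain : ∀ l → T (no1no2 l) → NoPlain 1 l × NoPlain 2 l
T-no1no2⇒NoPlain l holds with Equivalence.to T-∧ holds
... | no1 , no2 = hasPlain≡false⇒NoPlain 1 l (Equivalence.to T-not-≡ no1) ,
                  hasPlain≡false⇒NoPlain 2 l (Equivalence.to T-not-≡ no2)

module _ {a b : ℕ} (2≤a : 2 ≤ a) (2≤b : 2 ≤ b) where

  private
    Pairs : List (OverPartition × OverPartition)
    Pairs = cartesianProduct (counted no1 a) (counted no2 b)

    1≤a : 1 ≤ a
    1≤a = ≤-trans (s≤s z≤n) 2≤a

    admissible-counted : ∀ {l} → l ∈ counted no1no2 (a + b) → Admissible l × size l ≡ a + b
    admissible-counted l∈ with ∈-counted⁻ no1no2 l∈
    ... | record { canonical = c ; positive = pos ; size≡ = size-l } , holds =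
      let (n1 , n2) = T-no1no2⇒NoPlain _ holds in admissible c pos n1 n2 , size-l

  encode-∈ : ∀ {l} → l ∈ counted no1no2 (a + b) → encode a l ∈ Pairs
  encode-∈ l∈ =
    let (adm , size-l) = admissible-counted l∈
        (μ-ok , n1) = encode-front 1≤a adm size-l
        (ν-ok , n2) = encode-back 1≤a adm size-l
    in ∈-cartesianProduct⁺ (∈-counted⁺ no1 μ-ok (NoPlain⇒T-no 1 n1))
                           (∈-counted⁺ no2 ν-ok (NoPlain⇒T-no 2 n2))

  encode-injective : ∀ {l l′} → l ∈ counted no1no2 (a + b) → l′ ∈ counted no1no2 (a + b) →
    encode a l ≡ encode a l′ → l ≡ l′
  encode-injective l∈ l′∈ e =
    let (adm , size-l) = admissible-counted l∈
        (adm′ , size-l′) = admissible-counted l′∈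
    in trans (sym (decode-encode 1≤a adm size-l 2≤b))
             (trans (cong (uncurry decode) e) (decode-encode 1≤a adm′ size-l′ 2≤b))

  missed : OverPartition × OverPartition
  missed = twos a , (b , true) ∷ []

  missed-∈ : missed ∈ Pairs
  missed-∈ =
    let (twos-ok , n1) = twos-valid a
    in ∈-cartesianProduct⁺
         (∈-counted⁺ no1 twos-ok (NoPlain⇒T-no 1 n1))
         (∈-counted⁺ no2 b̄-ok (NoPlain⇒T-no 2 {(b , true) ∷ []} (∧-zeroʳ (b ≡ᵇ 2) ∷ [])))
    where
    b̄-ok : IsOverpartition b ((b , true) ∷ [])
    b̄-ok = record { canonical = [-] ; positive = ≤-trans (s≤s z≤n) 2≤b ∷ [] ; size≡ = +-identityʳ b }

  missed-∉ : missed ∉ map (encode a) (counted no1no2 (a + b))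
  missed-∉ m∈ with ∈-map⁻ (encode a) m∈
  ... | l , l∈ , m≡ with admissible-counted l∈
  ... | adm , size-l = ¬NoPlain2-decode-twos a b 2≤a (subst (NoPlain 2) l≡ (Admissible.noPlain2 adm))
    where
    l≡ : l ≡ decode (twos a) ((b , true) ∷ [])
    l≡ = trans (sym (decode-encode 1≤a adm size-l 2≤b)) (cong (uncurry decode) (sym m≡))

  p̄-no1*p̄-no2>p̄-no1no2 : p̄ no1 a * p̄ no2 b > p̄ no1no2 (a + b)
  p̄-no1*p̄-no2>p̄-no1no2 =
    subst (p̄ no1no2 (a + b) <_) (length-cartesianProduct (counted no1 a) (counted no2 b))
      (length-<-injection (encode a) (Unique-counted no1no2 (a + b)) encode-injective encode-∈ missed-∈ missed-∉)

lemma2p1 : (a b : ℕ) → a ≥ b → b ≥ 2 →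
    p̄ no1 a * p̄ no2 b > p̄ no1no2 (a + b)
lemma2p1 a b a≥b b≥2 = p̄-no1*p̄-no2>p̄-no1no2 (≤-trans b≥2 a≥b) b≥2
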